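{- Let $n\ge4$ and let $\mathcal{R}$ be a strict polarized rectifier network with $m$ edges realizing $K_n$, and let $x$ be a base vertex of $\mathcal{R}$. If the total degree of $x$ is at least $3$, then there is a strict polarized rectifier network realizing $K_{n-1}$ with at most $m-3$ edges.
   Context: $K_n$ denotes the diagram on $n$ vertices in which every pair of distinct vertices is joined by an undirected edge (the associated diagram of $\bigwedge_{i<j}(\overline{x_i}\lor\overline{x_j})$). A diagram is a loopless graph with undirected and directed edges such that for all $u,v$ at most one of $\{u,v\},(u,v),(v,u)$ is an edge. A polarized diagram of a diagram is a pair $(G',p)$ where $G'$ is obtained by orienting each undirected edge arbitrarily and $p:E(G')\to\{ -,+\}$ assigns $-$ to formerly undirected edges and $+$ to originally directed edges. A polarized rectifier network (PRN) is $\mathcal{R}=(B,A,E,p)$ with $B,A$ disjoint vertex sets (base and auxiliary), $(B\sqcup A,E)$ a loopless directed graph (the total degree of a vertex is its number of incident edges, incoming plus outgoing), and $p:\{(u,v)\in E:v\in B\}\to\{ -,+\}$. For $u,v\in B$ (possibly equal), a valid walk from $u$ to $v$ is a sequence $(\pi_1,\dots,\pi_k)$, $k\ge2$, with $\pi_1=u$, $\pi_k=v$, each $(\pi_i,\pi_{i+1})\in E$, and $\pi_i\in A$ for $2\le i\le k-1$; its polarity is $p(\pi_{k-1},\pi_k)$. A PRN $(V(G'),A,E,p')$ realizes $(G',p)$ if for all $u,v\in V(G')$ (possibly equal), $(u,v)\in E(G')$ iff there is a valid walk from $u$ to $v$ with polarity $p(u,v)$ (and there is no valid walk when $(u,v)\notin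 E(G')$); it realizes a diagram $G$ if it realizes some polarized diagram of $G$. A PRN is strict if (1) for every 2-element $\{u,v\}\subseteq B$ there is at most one valid walk from $u$ to $v$ or from $v$ to $u$ in total, and (2) every vertex of $A$ lies on some valid walk. -}

module Defs where

open import Data.Nat using (ℕ; _≤_; _∸_)
open import Data.Fin using (Fin)
import Data.Fin.Properties as FinP
open import Data.Sum using (_⊎_; inj₁; inj₂)
open import Data.Sum.Properties using (≡-dec)
open import Data.Product using (Σ; _×_; _,_; proj₁; proj₂; ∃; ∃-syntax)
open import Data.Bool using (Bool; true; false)
open import Data.List using (List; []; _∷_; length; filter)
open import Data.List.Membership.Propositional using (_∈_)
open import Data.List.Relation.Unary.Unique.Propositional using (Unique)
open import Relation.Binary.PropositionalEquality using (_≡_; _≢_)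
open import Relation.Nullary using (¬_; _⊎-dec_)

data Pol : Set where
  neg pos : Pol

-- Vertices of a PRN with base set Fin n and auxiliary set Fin a
Vtx : ℕ → ℕ → Set
Vtx n a = Fin n ⊎ Fin a

-- Edge set: a duplicate-free list of directed edges (so #edges = length E).
-- Polarity: given as a total function on pairs (source, base target);
-- only its values on edges of E matter.
record PRN (n : ℕ) : Set where
  field
    a        : ℕ
    E        : List (Vtx n a × Vtx n a)
    p        : Vtx n a → Fin n → Pol
    unique   : Unique E
    loopless : ∀ {u v} → (u , v) ∈ E → u ≢ v
open PRN public

edges : ∀ {n} → PRN n → ℕ
edges R = length (E R)

degree : ∀ {n} → (R : PRN n) → Fin n → ℕ
degree {n} R x =
  length (filter (λ e → ≡-dec FinP._≟_ FinP._≟_ (proj₁ e) (inj₁ x)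
                        ⊎-dec ≡-dec FinP._≟_ FinP._≟_ (proj₂ e) (inj₁ x)) (E R))

data AuxPath {n : ℕ} (R : PRN n) : Vtx n (a R) → Fin n → Set where
  last : ∀ {y v} → (y , inj₁ v) ∈ E R → AuxPath R y v
  step : ∀ {y c v} → (y , inj₂ c) ∈ E R → AuxPath R (inj₂ c) v → AuxPath R y v

Walk : ∀ {n} → (R : PRN n) → Fin n → Fin n → Set
Walk R u v = AuxPath R (inj₁ u) v

-- vertex sequence (π₂, ..., π_k) after the start vertex
tailSeq : ∀ {n} {R : PRN n} {y v} → AuxPath R y v → List (Vtx n (a R))
tailSeq {v = v} (last _) = inj₁ v ∷ []
tailSeq (step {c = c} _ w) = inj₂ c ∷ tailSeq w

seq : ∀ {n} {R : PRN n} {u v} → Walk R u v → List (Vtx n (a R))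
seq {u = u} w = inj₁ u ∷ tailSeq w

polarity : ∀ {n} {R : PRN n} {y v} → AuxPath R y v → Pol
polarity {R = R} {y = y} {v = v} (last _) = p R y v
polarity (step _ w) = polarity w

Strict : ∀ {n} → PRN n → Set
Strict {n} R =
  (∀ (u v : Fin n) → u ≢ v →
     ∀ (w₁ w₂ : Walk R u v ⊎ Walk R v u) → seqOf w₁ ≡ seqOf w₂)
  ×
  (∀ (c : Fin (a R)) → ∃[ u ] ∃[ v ] Σ (Walk R u v) (λ w → inj₂ c ∈ seq w))
  where
  seqOf : ∀ {u v} → Walk R u v ⊎ Walk R v u → List (Vtx n (a R))
  seqOf (inj₁ w) = seq w
  seqOf (inj₂ w) = seq w

-- Polarized diagrams of K_n: orientations of every edge {u,v} (u ≠ v), all with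
-- polarity −.
IsOrientationK : (n : ℕ) → (Fin n → Fin n → Bool) → Set
IsOrientationK n D =
  (∀ u → D u u ≡ false) ×
  (∀ u v → u ≢ v → (D u v ≡ true × D v u ≡ false) ⊎ (D u v ≡ false × D v u ≡ true))

RealizesOrient : ∀ {n} → PRN n → (Fin n → Fin n → Bool) → Set
RealizesOrient {n} R D =
  ∀ (u v : Fin n) →
    (D u v ≡ true → Σ (Walk R u v) (λ w → polarity w ≡ neg)) ×
    (D u v ≡ false → ¬ Walk R u v)

RealizesK : ∀ {n} → PRN n → Set
RealizesK {n} R = ∃[ D ] (IsOrientationK n D × RealizesOrient R D)

-- Deleting x together with its incident edges removes at least deg x ≥ 3 edges. Inner vertices
-- of valid walks are auxiliary, so every walk between two other base vertices survives with its
-- polarity; conversely walks of the smaller network are walks of the original one, so walks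
-- between distinct base vertices stay unique. Only condition (2) of strictness can fail, and it is
-- restored by deleting, one at a time, auxiliary vertices on no valid walk, which destroys no walk.
-- Whether an auxiliary vertex lies on a valid walk is decidable: it must be reachable from a base
-- vertex and reach one through auxiliary vertices, two reachability questions in a finite digraph.

module Submission where

open import Defs
open import Data.Bool using (Bool; true)
open import Data.Empty using (⊥; ⊥-elim)
open import Data.Fin using (Fin; punchIn; punchOut)
import Data.Fin.Properties as Fin
open import Data.List using (List; []; _∷_; length; filter; mapMaybe; map)
import Data.List.Properties as List
open import Data.List.Membership.Propositional using (_∈_)
import Data.List.Membership.DecPropositional as DecMembership
open import Data.List.Relation.Binary.Subset.Propositional using (_⊆_)
open import Data.List.Relation.Unary.All using (tabulate; lookup)
open import Data.List.Relation.Unary.AllPairs using ([]; _∷_)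
open import Data.List.Relation.Unary.Any using (here; there)
open import Data.List.Relation.Unary.Unique.Propositional using (Unique)
open import Data.Maybe as Maybe using (Maybe; just; nothing; zip)
import Data.Maybe.Properties as Maybeₚ
open import Data.Nat using (ℕ; zero; suc; pred; _≤_; _∸_; _+_; z≤n; s≤s)
open import Data.Nat.Properties using (≤-refl; ≤-trans; +-suc; m≤n⇒m≤1+n; m+n≤o⇒m≤o∸n; ∸-monoʳ-≤)
open import Data.Product as Product using (Σ; _×_; _,_; proj₁; proj₂; ∃-syntax)
import Data.Product.Properties as Productₚ
open import Data.Sum as Sum using (_⊎_; inj₁; inj₂)
import Data.Sum.Properties as Sumₚ
open import Function using (_∘_)
open import Relation.Binary.PropositionalEquality
  using (_≡_; _≢_; refl; sym; trans; cong; cong₂; subst; module ≡-Reasoning)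
open import Relation.Nullary using (Dec; yes; no)
open import Relation.Nullary.Decidable using (_×-dec_)
open import Relation.Binary.Definitions using (DecidableEquality)
open import Relation.Unary using (Pred; Decidable)

private
  variable
    A B C D : Set

module _ (f : A → Maybe B) where

  ∈-mapMaybe⁻ : ∀ {xs y} → y ∈ mapMaybe f xs → ∃[ x ] x ∈ xs × f x ≡ just y
  ∈-mapMaybe⁻ {x ∷ xs} y∈ with f x in fx
  ... | nothing = let x′ , x′∈ , fx′ = ∈-mapMaybe⁻ y∈ in x′ , there x′∈ , fx′
  ∈-mapMaybe⁻ {x ∷ xs} (here refl) | just _ = x , here refl , fx
  ∈-mapMaybe⁻ {x ∷ xs} (there y∈)  | just _ =
    let x′ , x′∈ , fx′ = ∈-mapMaybe⁻ y∈ in x′ , there x′∈ , fx′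

  ∈-mapMaybe⁺ : ∀ {xs x y} → x ∈ xs → f x ≡ just y → y ∈ mapMaybe f xs
  ∈-mapMaybe⁺ {x ∷ xs} (here refl) fx with f x
  ∈-mapMaybe⁺ {x ∷ xs} (here refl) refl | just _ = here refl
  ∈-mapMaybe⁺ {x′ ∷ xs} (there x∈) fx with f x′
  ... | nothing = ∈-mapMaybe⁺ x∈ fx
  ... | just _  = there (∈-mapMaybe⁺ x∈ fx)

  Unique-mapMaybe⁺ : (∀ {x x′ y} → f x ≡ just y → f x′ ≡ just y → x ≡ x′) →
                     ∀ {xs} → Unique xs → Unique (mapMaybe f xs)
  Unique-mapMaybe⁺ f-inj {[]}     []         = []
  Unique-mapMaybe⁺ f-inj {x ∷ xs} (x∉ ∷ xs!) with f x in fx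
  ... | nothing = Unique-mapMaybe⁺ f-inj xs!
  ... | just y  = tabulate y≢ ∷ Unique-mapMaybe⁺ f-inj xs!
    where
    y≢ : ∀ {y′} → y′ ∈ mapMaybe f xs → y ≢ y′
    y≢ y′∈ refl = let x′ , x′∈ , fx′ = ∈-mapMaybe⁻ y′∈ in lookup x∉ x′∈ (f-inj fx fx′)

  length-mapMaybe+filter : ∀ {p} {P : Pred A p} (P? : Decidable P) →
                           (∀ x → P x → f x ≡ nothing) →
                           ∀ xs → length (mapMaybe f xs) + length (filter P? xs) ≤ length xs
  length-mapMaybe+filter P? dropped []       = z≤n
  length-mapMaybe+filter P? dropped (x ∷ xs) with P? x
  ... | yes px rewrite dropped x px | +-suc (length (mapMaybe f xs)) (length (filter P? xs)) =
    s≤s (length-mapMaybe+filter P? dropped xs)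
  ... | no _ with f x
  ...   | nothing = m≤n⇒m≤1+n (length-mapMaybe+filter P? dropped xs)
  ...   | just _  = s≤s (length-mapMaybe+filter P? dropped xs)

record DecDigraph (m : ℕ) : Set₁ where
  field
    Target  : Fin m → Set
    target? : Decidable Target
    Edge    : Fin m → Fin m → Set
    edge?   : ∀ c d → Dec (Edge c d)
open DecDigraph

data Reaches {m} (g : DecDigraph m) : Fin m → Set where
  arrive : ∀ {c} → Target g c → Reaches g c
  move   : ∀ {c d} → Edge g c d → Reaches g d → Reaches g c

_─_ : ∀ {m} → DecDigraph (suc m) → Fin (suc m) → DecDigraph m
g ─ c = record
  { Target  = Target g ∘ punchIn c
  ; target? = target? g ∘ punchIn c
  ; Edge    = λ d e → Edge g (punchIn c d) (punchIn c e)
  ; edge?   = λ d e → edge? g (punchIn c d) (punchIn c e)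
  }

Reaches-punchIn : ∀ {m} {g : DecDigraph (suc m)} {c d} → Reaches (g ─ c) d → Reaches g (punchIn c d)
Reaches-punchIn (arrive t) = arrive t
Reaches-punchIn (move e r) = move e (Reaches-punchIn r)

module _ {m} (g : DecDigraph (suc m)) (c : Fin (suc m)) where

  ReachesWithoutReturning : Set
  ReachesWithoutReturning = Target g c ⊎ ∃[ d ] Edge g c (punchIn c d) × Reaches (g ─ c) d

  ReachesAvoiding : Fin (suc m) → Set
  ReachesAvoiding y = ∃[ y′ ] punchIn c y′ ≡ y × Reaches (g ─ c) y′

  avoid-or-return : ∀ {y} → Reaches g y → ReachesAvoiding y ⊎ ReachesWithoutReturning
  avoid-or-return {y} (arrive t) with y Fin.≟ c
  ... | yes refl = inj₂ (inj₁ t)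
  ... | no y≢c with punchOut (y≢c ∘ sym) | Fin.punchIn-punchOut (y≢c ∘ sym)
  ...   | y′ | refl = inj₁ (y′ , refl , arrive t)
  avoid-or-return {y} (move e r) with avoid-or-return r
  ... | inj₂ r′ = inj₂ r′
  ... | inj₁ (z′ , refl , r′) with y Fin.≟ c
  ...   | yes refl = inj₂ (inj₂ (z′ , e , r′))
  ...   | no y≢c with punchOut (y≢c ∘ sym) | Fin.punchIn-punchOut (y≢c ∘ sym)
  ...     | y′ | refl = inj₁ (y′ , refl , move e r′)

-- A path from c can be cut at its last visit to c, so recursion on g ─ c suffices.
reaches? : ∀ {m} (g : DecDigraph m) → Decidable (Reaches g)
reaches? {suc m} g c with target? g c
... | yes t = yes (arrive t)
... | no ¬t with Fin.any? (λ d → edge? g c (punchIn c d) ×-dec reaches? (g ─ c) d)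
...   | yes (d , e , r) = yes (move e (Reaches-punchIn r))
...   | no ¬leave = no (impossible ∘ avoid-or-return g c)
  where
  impossible : ReachesAvoiding g c c ⊎ ReachesWithoutReturning g c → ⊥
  impossible (inj₁ (c′ , c′↦c , _)) = Fin.punchInᵢ≢i c c′ c′↦c
  impossible (inj₂ (inj₁ t))         = ¬t t
  impossible (inj₂ (inj₂ leave))     = ¬leave leave

record Embedding (A B : Set) : Set where
  field
    embed          : A → B
    restrict       : B → Maybe A
    restrict-embed : ∀ x → restrict (embed x) ≡ just x
    embed-restrict : ∀ {y x} → restrict y ≡ just x → embed x ≡ y

  embed-injective : ∀ {x x′} → embed x ≡ embed x′ → x ≡ x′
  embed-injective {x} {x′} eq =
    Maybeₚ.just-injective (trans (sym (restrict-embed x)) (trans (cong restrict eq) (restrict-embed x′)))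

  ∈-restrict⁻ : ∀ {ys x} → x ∈ mapMaybe restrict ys → embed x ∈ ys
  ∈-restrict⁻ x∈ with ∈-mapMaybe⁻ restrict x∈
  ... | y , y∈ , y↦x rewrite embed-restrict y↦x = y∈

  ∈-restrict⁺ : ∀ {ys x} → embed x ∈ ys → x ∈ mapMaybe restrict ys
  ∈-restrict⁺ {x = x} x∈ = ∈-mapMaybe⁺ restrict x∈ (restrict-embed x)

  Unique-restrict : ∀ {ys} → Unique ys → Unique (mapMaybe restrict ys)
  Unique-restrict = Unique-mapMaybe⁺ restrict λ y↦x y′↦x →
    trans (sym (embed-restrict y↦x)) (embed-restrict y′↦x)

open Embedding

id-embedding : Embedding A A
id-embedding = record
  { embed = λ x → x ; restrict = just ; restrict-embed = λ _ → refl ; embed-restrict = λ { refl → refl } }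

_⊎-embedding_ : Embedding A B → Embedding C D → Embedding (A ⊎ C) (B ⊎ D)
_⊎-embedding_ {A} {B} {C} {D} ε δ = record
  { embed          = Sum.map (embed ε) (embed δ)
  ; restrict       = restrict′
  ; restrict-embed = restrict′-embed
  ; embed-restrict = λ {y} → embed-restrict′ y
  }
  where
  restrict′ : B ⊎ D → Maybe (A ⊎ C)
  restrict′ (inj₁ y) = Maybe.map inj₁ (restrict ε y)
  restrict′ (inj₂ y) = Maybe.map inj₂ (restrict δ y)

  restrict′-embed : ∀ x → restrict′ (Sum.map (embed ε) (embed δ) x) ≡ just x
  restrict′-embed (inj₁ x) rewrite restrict-embed ε x = refl
  restrict′-embed (inj₂ x) rewrite restrict-embed δ x = refl

  embed-restrict′ : ∀ y {x} → restrict′ y ≡ just x → Sum.map (embed ε) (embed δ) x ≡ y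
  embed-restrict′ (inj₁ y) eq with restrict ε y in y↦
  embed-restrict′ (inj₁ y) refl | just _ = cong inj₁ (embed-restrict ε y↦)
  embed-restrict′ (inj₂ y) eq with restrict δ y in y↦
  embed-restrict′ (inj₂ y) refl | just _ = cong inj₂ (embed-restrict δ y↦)

_×-embedding_ : Embedding A B → Embedding C D → Embedding (A × C) (B × D)
_×-embedding_ {A} {B} {C} {D} ε δ = record
  { embed          = Product.map (embed ε) (embed δ)
  ; restrict       = restrict′
  ; restrict-embed = λ (x , z) → cong₂ zip (restrict-embed ε x) (restrict-embed δ z)
  ; embed-restrict = λ {y} → embed-restrict′ y
  }
  where
  restrict′ : B × D → Maybe (A × C)
  restrict′ (y , w) = zip (restrict ε y) (restrict δ w)

  embed-restrict′ : ∀ y {x} → restrict′ y ≡ just x → Product.map (embed ε) (embed δ) x ≡ y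
  embed-restrict′ (y , w) eq with restrict ε y in y↦ | restrict δ w in w↦
  embed-restrict′ (y , w) refl | just _ | just _ = cong₂ _,_ (embed-restrict ε y↦) (embed-restrict δ w↦)

deleting : ∀ {m} (c : Fin m) → Embedding (Fin (pred m)) (Fin m)
deleting {suc m} c = record
  { embed          = punchIn c
  ; restrict       = restrict′
  ; restrict-embed = restrict′-punchIn
  ; embed-restrict = λ {d} → punchIn-restrict′ d
  }
  where
  restrict′ : Fin (suc m) → Maybe (Fin m)
  restrict′ d with d Fin.≟ c
  ... | yes _   = nothing
  ... | no d≢c = just (punchOut (d≢c ∘ sym))

  restrict′-punchIn : ∀ d → restrict′ (punchIn c d) ≡ just d
  restrict′-punchIn d with punchIn c d Fin.≟ c
  ... | yes d↦c = ⊥-elim (Fin.punchInᵢ≢i c d d↦c)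
  ... | no _     = cong just (trans (Fin.punchOut-cong c refl) (Fin.punchOut-punchIn c))

  punchIn-restrict′ : ∀ d {d′} → restrict′ d ≡ just d′ → punchIn c d′ ≡ d
  punchIn-restrict′ d eq with d Fin.≟ c
  punchIn-restrict′ d refl | no d≢c = Fin.punchIn-punchOut (d≢c ∘ sym)

restrict-deleting-self : ∀ {m} (c : Fin m) → restrict (deleting c) c ≡ nothing
restrict-deleting-self {suc m} c with c Fin.≟ c
... | yes _   = refl
... | no c≢c = ⊥-elim (c≢c refl)

embed-deleting-onto : ∀ {m} (c : Fin m) {d} → d ≢ c → ∃[ d′ ] embed (deleting c) d′ ≡ d
embed-deleting-onto {suc m} c d≢c = punchOut (d≢c ∘ sym) , Fin.punchIn-punchOut (d≢c ∘ sym)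

-- Strict restated through a top-level seqEither, since the one local to Strict is out of scope.

module _ {n} (R : PRN n) where

  seqEither : ∀ {u v} → Walk R u v ⊎ Walk R v u → List (Vtx n (a R))
  seqEither (inj₁ w) = seq w
  seqEither (inj₂ w) = seq w

  UniqueWalks : Set
  UniqueWalks = ∀ u v → u ≢ v → ∀ (w₁ w₂ : Walk R u v ⊎ Walk R v u) → seqEither w₁ ≡ seqEither w₂

  OnValidWalk : Fin (a R) → Set
  OnValidWalk c = ∃[ u ] ∃[ v ] Σ (Walk R u v) (λ w → inj₂ c ∈ seq w)

  Strict⇒UniqueWalks : Strict R → UniqueWalks
  Strict⇒UniqueWalks (unique , _) u v u≢v (inj₁ w₁) (inj₁ w₂) = unique u v u≢v (inj₁ w₁) (inj₁ w₂)
  Strict⇒UniqueWalks (unique , _) u v u≢v (inj₁ w₁) (inj₂ w₂) = unique u v u≢v (inj₁ w₁) (inj₂ w₂)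
  Strict⇒UniqueWalks (unique , _) u v u≢v (inj₂ w₁) (inj₁ w₂) = unique u v u≢v (inj₂ w₁) (inj₁ w₂)
  Strict⇒UniqueWalks (unique , _) u v u≢v (inj₂ w₁) (inj₂ w₂) = unique u v u≢v (inj₂ w₁) (inj₂ w₂)

  UniqueWalks⇒Strict : UniqueWalks → (∀ c → OnValidWalk c) → Strict R
  UniqueWalks⇒Strict unique onWalk =
    (λ { u v u≢v (inj₁ w₁) (inj₁ w₂) → unique u v u≢v (inj₁ w₁) (inj₁ w₂)
       ; u v u≢v (inj₁ w₁) (inj₂ w₂) → unique u v u≢v (inj₁ w₁) (inj₂ w₂)
       ; u v u≢v (inj₂ w₁) (inj₁ w₂) → unique u v u≢v (inj₂ w₁) (inj₁ w₂)
       ; u v u≢v (inj₂ w₁) (inj₂ w₂) → unique u v u≢v (inj₂ w₁) (inj₂ w₂) })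
    , onWalk

StrictRealizationWithin : (n m : ℕ) → Set
StrictRealizationWithin n m = Σ (PRN n) (λ R′ → Strict R′ × RealizesK R′ × edges R′ ≤ m)

StrictRealizationWithin-mono : ∀ {n m m′} → m ≤ m′ →
                               StrictRealizationWithin n m → StrictRealizationWithin n m′
StrictRealizationWithin-mono m≤m′ (R′ , strict , realizes , R′≤m) = R′ , strict , realizes , ≤-trans R′≤m m≤m′

module Restriction {n n′ a′} (R : PRN n)
                   (β : Embedding (Fin n′) (Fin n)) (α : Embedding (Fin a′) (Fin (a R))) where

  ν : Embedding (Vtx n′ a′) (Vtx n (a R))
  ν = β ⊎-embedding α

  ν² : Embedding (Vtx n′ a′ × Vtx n′ a′) (Vtx n (a R) × Vtx n (a R))
  ν² = ν ×-embedding ν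

  restriction : PRN n′
  restriction = record
    { a        = a′
    ; E        = mapMaybe (restrict ν²) (E R)
    ; p        = λ y v → p R (embed ν y) (embed β v)
    ; unique   = Unique-restrict ν² (unique R)
    ; loopless = λ e∈ y≡v → loopless R (∈-restrict⁻ ν² e∈) (cong (embed ν) y≡v)
    }

  edges-restriction+filter : ∀ {p} {P : Pred (Vtx n (a R) × Vtx n (a R)) p} (P? : Decidable P) →
                             (∀ e → P e → restrict ν² e ≡ nothing) →
                             edges restriction + length (filter P? (E R)) ≤ edges R
  edges-restriction+filter P? dropped = length-mapMaybe+filter (restrict ν²) P? dropped (E R)

  edges-restriction : edges restriction ≤ edges R
  edges-restriction = List.length-mapMaybe (restrict ν²) (E R)

  embed-path : ∀ {y v} → AuxPath restriction y v → AuxPath R (embed ν y) (embed β v)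
  embed-path (last e)   = last (∈-restrict⁻ ν² e)
  embed-path (step e w) = step (∈-restrict⁻ ν² e) (embed-path w)

  tailSeq-embed-path : ∀ {y v} (w : AuxPath restriction y v) →
                       tailSeq (embed-path w) ≡ map (embed ν) (tailSeq w)
  tailSeq-embed-path (last e)   = refl
  tailSeq-embed-path (step e w) = cong (_ ∷_) (tailSeq-embed-path w)

  AuxInImage : ∀ {y v} → AuxPath R y v → Set
  AuxInImage w = ∀ d → inj₂ d ∈ tailSeq w → ∃[ d′ ] embed α d′ ≡ d

  restrict-path : ∀ {y v} (w : AuxPath R y v) → AuxInImage w →
                  ∀ {y′ v′} → embed ν y′ ≡ y → embed β v′ ≡ v →
                  Σ (AuxPath restriction y′ v′) (λ w′ → polarity w′ ≡ polarity w)
  restrict-path (last e) _ refl refl = last (∈-restrict⁺ ν² e) , refl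
  restrict-path (step {c = c} e w) inImage refl refl with inImage c (here refl)
  ... | c′ , refl =
    let w′ , w′-pol = restrict-path w (λ d d∈ → inImage d (there d∈)) {inj₂ c′} refl refl
    in step (∈-restrict⁺ ν² e) w′ , w′-pol

  restriction-UniqueWalks : UniqueWalks R → UniqueWalks restriction
  restriction-UniqueWalks unique u v u≢v w₁ w₂ =
    List.map-injective (embed-injective ν) (begin
      map (embed ν) (seqEither restriction w₁) ≡⟨ seq-embed w₁ ⟨
      seqEither R (embed-walk w₁)              ≡⟨ unique (embed β u) (embed β v) (u≢v ∘ embed-injective β) _ _ ⟩
      seqEither R (embed-walk w₂)              ≡⟨ seq-embed w₂ ⟩
      map (embed ν) (seqEither restriction w₂) ∎)
    where
    open ≡-Reasoning
    embed-walk : Walk restriction u v ⊎ Walk restriction v u →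
                 Walk R (embed β u) (embed β v) ⊎ Walk R (embed β v) (embed β u)
    embed-walk = Sum.map embed-path embed-path
    seq-embed : ∀ w → seqEither R (embed-walk w) ≡ map (embed ν) (seqEither restriction w)
    seq-embed (inj₁ w) = cong (_ ∷_) (tailSeq-embed-path w)
    seq-embed (inj₂ w) = cong (_ ∷_) (tailSeq-embed-path w)

  restriction-RealizesK : (∀ {u v} (w : Walk R (embed β u) (embed β v)) → AuxInImage w) →
                          RealizesK R → RealizesK restriction
  restriction-RealizesK inImage (D , (irreflexive , total) , realizes) =
    D′ , (irreflexive ∘ embed β , λ u v u≢v → total (embed β u) (embed β v) (u≢v ∘ embed-injective β))
       , realizes′
    where
    D′ : Fin n′ → Fin n′ → Bool
    D′ u v = D (embed β u) (embed β v)
    realizes′ : RealizesOrient restriction D′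
    realizes′ u v = from-R , λ u↛v w → proj₂ (realizes (embed β u) (embed β v)) u↛v (embed-path w)
      where
      from-R : D′ u v ≡ true → Σ (Walk restriction u v) (λ w → polarity w ≡ neg)
      from-R u→v with proj₁ (realizes (embed β u) (embed β v)) u→v
      ... | w , w-neg with restrict-path w (inImage w) {inj₁ u} refl refl
      ...   | w′ , w′-pol = w′ , trans w′-pol w-neg

module _ {n} (R : PRN n) where

  private
    _≟ᵉ_ : DecidableEquality (Vtx n (a R) × Vtx n (a R))
    _≟ᵉ_ = Productₚ.≡-dec (Sumₚ.≡-dec Fin._≟_ Fin._≟_) (Sumₚ.≡-dec Fin._≟_ Fin._≟_)
    open DecMembership _≟ᵉ_ using (_∈?_)

  -- Reaches forward c: c reaches a base vertex through auxiliary vertices;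
  -- Reaches backward c: c is reached from a base vertex through auxiliary vertices.
  forward backward : DecDigraph (a R)
  forward = record
    { Target  = λ c → ∃[ v ] (inj₂ c , inj₁ v) ∈ E R
    ; target? = λ c → Fin.any? (λ v → (inj₂ c , inj₁ v) ∈? E R)
    ; Edge    = λ c d → (inj₂ c , inj₂ d) ∈ E R
    ; edge?   = λ c d → (inj₂ c , inj₂ d) ∈? E R
    }
  backward = record
    { Target  = λ c → ∃[ u ] (inj₁ u , inj₂ c) ∈ E R
    ; target? = λ c → Fin.any? (λ u → (inj₁ u , inj₂ c) ∈? E R)
    ; Edge    = λ c d → (inj₂ d , inj₂ c) ∈ E R
    ; edge?   = λ c d → (inj₂ d , inj₂ c) ∈? E R
    }

  Reaches-forward⇒path : ∀ {c} → Reaches forward c → ∃[ v ] AuxPath R (inj₂ c) v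
  Reaches-forward⇒path (arrive (v , e)) = v , last e
  Reaches-forward⇒path (move e r)       = let v , w = Reaches-forward⇒path r in v , step e w

  path⇒Reaches-forward : ∀ {c v} → AuxPath R (inj₂ c) v → Reaches forward c
  path⇒Reaches-forward (last e)   = arrive (_ , e)
  path⇒Reaches-forward (step e w) = move e (path⇒Reaches-forward w)

  prepend-backward : ∀ {d v} → Reaches backward d → (q : AuxPath R (inj₂ d) v) →
                     ∃[ u ] Σ (Walk R u v) (λ w → inj₂ d ∷ tailSeq q ⊆ tailSeq w)
  prepend-backward (arrive (u , e)) q = u , step e q , λ z∈ → z∈
  prepend-backward (move e r)       q = let u , w , q⊆w = prepend-backward r (step e q) in u , w , q⊆w ∘ there

  suffix⇒Reaches-forward : ∀ {y v c} (w : AuxPath R y v) → inj₂ c ∈ tailSeq w → Reaches forward c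
  suffix⇒Reaches-forward (last e)   (there ())
  suffix⇒Reaches-forward (step e w) (here refl) = path⇒Reaches-forward w
  suffix⇒Reaches-forward (step e w) (there c∈)  = suffix⇒Reaches-forward w c∈

  prefix⇒Reaches-backward : ∀ {y v c} (w : AuxPath R y v) → inj₂ c ∈ tailSeq w →
                            (∀ {d} → (y , inj₂ d) ∈ E R → Reaches backward d) → Reaches backward c
  prefix⇒Reaches-backward (last e)   (there ()) _
  prefix⇒Reaches-backward (step e w) (here refl) first = first e
  prefix⇒Reaches-backward (step e w) (there c∈)  first = prefix⇒Reaches-backward w c∈ (λ e′ → move e′ (first e))

  onValidWalk? : Decidable (OnValidWalk R)
  onValidWalk? c with reaches? backward c ×-dec reaches? forward c
  ... | yes (from-base , to-base) =
    let v , q = Reaches-forward⇒path to-base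
        u , w , q⊆w = prepend-backward from-base q
    in yes (u , v , w , there (q⊆w (here refl)))
  ... | no ¬reach = no λ
    { (u , v , w , here ())
    ; (u , v , w , there c∈) →
        ¬reach (prefix⇒Reaches-backward w c∈ (λ e → arrive (u , e)) , suffix⇒Reaches-forward w c∈)
    }

prune : ∀ {n} k (R : PRN n) → a R ≡ k → UniqueWalks R → RealizesK R →
        StrictRealizationWithin n (edges R)
prune k R a≡k unique realizes with Fin.all? (onValidWalk? R)
... | yes onWalk = R , UniqueWalks⇒Strict R unique onWalk , realizes , ≤-refl
... | no ¬onWalk with Fin.¬∀⟶∃¬ _ _ (onValidWalk? R) ¬onWalk
prune zero    R a≡0 _ _ | no _ | c , _ = ⊥-elim (Fin.¬Fin0 (subst Fin a≡0 c))
prune (suc k) R a≡1+k unique realizes | no _ | c , off =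
  StrictRealizationWithin-mono edges-restriction
    (prune k restriction (cong pred a≡1+k)
      (restriction-UniqueWalks unique)
      (restriction-RealizesK inImage realizes))
  where
  open Restriction R id-embedding (deleting c)
  inImage : ∀ {u v} (w : Walk R u v) → AuxInImage w
  inImage {u} {v} w d d∈ = embed-deleting-onto c λ { refl → off (u , v , w , there d∈) }

lemma30 : (n : ℕ) → 4 ≤ n → (R : PRN n) → Strict R → RealizesK R →
    (x : Fin n) → 3 ≤ degree R x →
    Σ (PRN (n ∸ 1)) (λ R′ → Strict R′ × RealizesK R′ × edges R′ ≤ edges R ∸ 3)
lemma30 (suc n) _ R strict realizes x 3≤deg =
  StrictRealizationWithin-mono (≤-trans (m+n≤o⇒m≤o∸n _ count) (∸-monoʳ-≤ (edges R) 3≤deg))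
    (prune _ restriction refl
      (restriction-UniqueWalks (Strict⇒UniqueWalks R strict))
      (restriction-RealizesK (λ _ d _ → d , refl) realizes))
  where
  open Restriction R (deleting x) id-embedding
  incident-dropped : ∀ e → proj₁ e ≡ inj₁ x ⊎ proj₂ e ≡ inj₁ x → restrict ν² e ≡ nothing
  incident-dropped (_ , _) (inj₁ refl) rewrite restrict-deleting-self x = refl
  incident-dropped (y , _) (inj₂ refl) rewrite restrict-deleting-self x with restrict ν y
  ... | just _  = refl
  ... | nothing = refl
  count : edges restriction + degree R x ≤ edges R
  count = edges-restriction+filter _ incident-dropped
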